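{- Let $q$ be a prime power, $n\geq1$, $1\neq\sigma\in\mathrm{Aut}(\mathbb F_q)$, and let $X_1,\dots,X_N\in M_{n+1}(q)$ be representatives of the points of $\Lambda_\sigma$. Then the map $ev: M_{n+1}(q)\to\mathcal C(\Lambda_\sigma)$, $M\mapsto c_M=(\mathrm{Tr}(X_1M),\dots,\mathrm{Tr}(X_NM))$ is a vector space isomorphism.
   Context: $V=\mathbb F_q^{n+1}$ (column vectors), $V^*$ row vectors; $A^\sigma$ means $\sigma$ applied entrywise. $\Lambda_\sigma=\{[x^\sigma\xi]: x\in V\setminus\{0\},\xi\in V^*\setminus\{0\},\xi x=0\}\subseteq\mathrm{PG}(M_{n+1}(q))$ and $\mathcal C(\Lambda_\sigma)=\{c_M:M\in M_{n+1}(q)\}\subseteq\mathbb F_q^N$. -}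

module Defs where

open import Level using (0ℓ)
open import Data.Nat using (ℕ; zero; suc; _^_)
open import Data.Nat.Primality using (Prime)
open import Data.Fin using (Fin)
open import Data.List using (List; length)
open import Data.List.Membership.Propositional using (_∈_)
open import Data.List.Relation.Unary.Unique.Propositional using (Unique)
open import Data.Product using (Σ; ∃; _×_; _,_)
open import Relation.Binary.PropositionalEquality using (_≡_; _≢_)
open import Relation.Nullary using (¬_)
open import Relation.Binary.Definitions using (DecidableEquality)
open import Algebra.Structures using (IsCommutativeRing)

record FiniteField (q : ℕ) : Set₁ where
  infixl 7 _*_
  infixl 6 _+_
  field
    Carrier : Set
    _+_ _*_ : Carrier → Carrier → Carrier
    -_      : Carrier → Carrier
    0# 1#   : Carrier
    isCommutativeRing : IsCommutativeRing _≡_ _+_ _*_ -_ 0# 1#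
    0≢1     : 0# ≢ 1#
    inverse : ∀ x → x ≢ 0# → ∃ λ y → x * y ≡ 1#
    _≟_     : DecidableEquality Carrier
    elements : List Carrier
    complete : ∀ x → x ∈ elements
    unique   : Unique elements
    card     : length elements ≡ q

module _ {q : ℕ} (F : FiniteField q) where
  open FiniteField F

  record Automorphism : Set where
    field
      σ       : Carrier → Carrier
      σ-+     : ∀ x y → σ (x + y) ≡ σ x + σ y
      σ-*     : ∀ x y → σ (x * y) ≡ σ x * σ y
      σ-1     : σ 1# ≡ 1#
      σ⁻¹     : Carrier → Carrier
      σ⁻¹∘σ   : ∀ x → σ⁻¹ (σ x) ≡ x
      σ∘σ⁻¹   : ∀ x → σ (σ⁻¹ x) ≡ x

  NonTrivial : Automorphism → Set
  NonTrivial s = ¬ (∀ x → Automorphism.σ s x ≡ x)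

  Σ[_] : (m : ℕ) → (Fin m → Carrier) → Carrier
  Σ[ zero ] f = 0#
  Σ[ suc m ] f = f Fin.zero + Σ[ m ] (λ i → f (Fin.suc i))

  -- column vectors of V = F^m, row vectors of V*, m×m matrices
  Vect : ℕ → Set
  Vect m = Fin m → Carrier

  Matrix : ℕ → Set
  Matrix m = Fin m → Fin m → Carrier

  NonZeroVec : ∀ {m} → Vect m → Set
  NonZeroVec x = ¬ (∀ i → x i ≡ 0#)

  NonZeroMat : ∀ {m} → Matrix m → Set
  NonZeroMat X = ¬ (∀ i j → X i j ≡ 0#)

  _≈M_ : ∀ {m} → Matrix m → Matrix m → Set
  X ≈M Y = ∀ i j → X i j ≡ Y i j

  pairing : ∀ {m} → Vect m → Vect m → Carrier
  pairing {m} ξ x = Σ[ m ] (λ i → ξ i * x i)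

  twistedOuter : ∀ {m} → Automorphism → Vect m → Vect m → Matrix m
  twistedOuter s x ξ i j = Automorphism.σ s (x i) * ξ j

  scaleM : ∀ {m} → Carrier → Matrix m → Matrix m
  scaleM a X i j = a * X i j

  addM : ∀ {m} → Matrix m → Matrix m → Matrix m
  addM X Y i j = X i j + Y i j

  mulM : ∀ {m} → Matrix m → Matrix m → Matrix m
  mulM {m} X Y i j = Σ[ m ] (λ k → X i k * Y k j)

  trace : ∀ {m} → Matrix m → Carrier
  trace {m} X = Σ[ m ] (λ i → X i i)

  -- X and Y represent the same point of PG(M_m(q)): X = λY for some λ ≠ 0
  SamePoint : ∀ {m} → Matrix m → Matrix m → Set
  SamePoint X Y = ∃ λ a → a ≢ 0# × X ≈M scaleM a Y

  IsΛGenerator : ∀ {m} → Automorphism → Matrix m → Set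
  IsΛGenerator {m} s Y =
    Σ (Vect m) λ x → Σ (Vect m) λ ξ →
      NonZeroVec x × NonZeroVec ξ × pairing ξ x ≡ 0# × Y ≈M twistedOuter s x ξ

  RepresentsΛPoint : ∀ {m} → Automorphism → Matrix m → Set
  RepresentsΛPoint s X = NonZeroMat X × ∃ λ Y → IsΛGenerator s Y × SamePoint X Y

  Representatives : ∀ {m} → Automorphism → (N : ℕ) → (Fin N → Matrix m) → Set
  Representatives {m} s N X =
    (∀ i → RepresentsΛPoint s (X i)) ×
    (∀ Y → IsΛGenerator s Y → ∃ λ i → SamePoint (X i) Y) ×
    (∀ i j → SamePoint (X i) (X j) → i ≡ j)

  ev : ∀ {m N} → (Fin N → Matrix m) → Matrix m → (Fin N → Carrier)
  ev X M k = trace (mulM (X k) M)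

  InCode : ∀ {m N} → (Fin N → Matrix m) → (Fin N → Carrier) → Set
  InCode {m} X c = ∃ λ (M : Matrix m) → ∀ k → ev X M k ≡ c k

  IsVSIsoOntoCode : ∀ {m N} → (Fin N → Matrix m) → (Matrix m → (Fin N → Carrier)) → Set
  IsVSIsoOntoCode {m} X f =
    (∀ M → InCode X (f M)) ×
    (∀ a b M M' k → f (addM (scaleM a M) (scaleM b M')) k ≡ a * f M k + b * f M' k) ×
    (∀ M M' → (∀ k → f M k ≡ f M' k) → M ≈M M') ×
    (∀ c → InCode X c → ∃ λ M → ∀ k → f M k ≡ c k)

IsPrimePower : ℕ → Set
IsPrimePower q = ∃ λ p → ∃ λ k → Prime p × q ≡ p ^ suc k

{-# OPTIONS --safe #-}
module Submission where

-- If c_M = 0, then Tr(x^σ ξ M) = ξ M x^σ vanishes for every incident pair (x, ξ), since each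
-- x^σ ξ is a nonzero multiple of some X_k. For i ≠ j (this needs n ≥ 1) the pair
-- x = e_i + a e_j, ξ = e_j - a e_i gives (M_ji - a M_ii) + a^σ (M_jj - a M_ij) = 0 for all a.
-- Taking a = 0 kills the off-diagonal entries; then a^σ M_jj = a M_ii, so M_jj = M_ii (a = 1)
-- and (a^σ - a) M_ii = 0 for all a, which forces M_ii = 0 because σ ≠ 1. Hence ev is
-- injective; it is linear by linearity of the trace, and onto C(Λ_σ) by definition.

open import Defs
open import Level using (0ℓ)
open import Data.Nat using (ℕ; zero; suc; _≤_; s≤s; z≤n)
open import Data.Fin using (Fin)
import Data.Fin as Fin
open import Data.Fin.Properties using (punchInᵢ≢i)
open import Data.Product using (∃; _,_)
open import Function using (_∘_)
open import Relation.Nullary using (yes; no; contradiction)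
open import Relation.Binary.PropositionalEquality
open import Algebra.Bundles using (CommutativeRing)
open import Algebra.Structures using (IsCommutativeRing)

module _ {q : ℕ} (F : FiniteField q) where
  open FiniteField F
  open IsCommutativeRing isCommutativeRing
    using ( *-comm; *-assoc; distribˡ; distribʳ; zeroˡ; zeroʳ
          ; +-identityˡ; +-identityʳ; *-identityˡ; *-identityʳ; -‿inverseˡ; -‿inverseʳ )

  commutativeRing : CommutativeRing 0ℓ 0ℓ
  commutativeRing = record { isCommutativeRing = isCommutativeRing }

  open CommutativeRing commutativeRing using (ring; semiring; *-commutativeSemigroup)
  open import Algebra.Properties.Ring ring
    using (-1*x≈-x; x+x≈x⇒x≈0; x∙y⁻¹≈ε⇒x≈y; x≈y⇒x∙y⁻¹≈ε; +-cancelˡ)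
  open import Algebra.Properties.Semiring.Sum semiring
    using (sum; sum-cong-≗; ∑-distrib-+; *-distribˡ-sum)
  open import Algebra.Properties.CommutativeSemigroup *-commutativeSemigroup
    using (x∙yz≈y∙xz)

  *-cancelʳ-≢0 : ∀ {c} a b → c ≢ 0# → a * c ≡ b * c → a ≡ b
  *-cancelʳ-≢0 {c} a b c≢0 ac≡bc with inverse c c≢0
  ... | c⁻¹ , cc⁻¹≡1 = begin
    a              ≡⟨ sym (*-identityʳ a) ⟩
    a * 1#         ≡⟨ cong (a *_) (sym cc⁻¹≡1) ⟩
    a * (c * c⁻¹)  ≡⟨ sym (*-assoc a c c⁻¹) ⟩
    a * c * c⁻¹    ≡⟨ cong (_* c⁻¹) ac≡bc ⟩
    b * c * c⁻¹    ≡⟨ *-assoc b c c⁻¹ ⟩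
    b * (c * c⁻¹)  ≡⟨ cong (b *_) cc⁻¹≡1 ⟩
    b * 1#         ≡⟨ *-identityʳ b ⟩
    b              ∎
    where open ≡-Reasoning

  1x-1y≡x-y : ∀ x y → 1# * x + - 1# * y ≡ x + - y
  1x-1y≡x-y x y = cong₂ _+_ (*-identityˡ x) (-1*x≈-x y)

  Σ : (m : ℕ) → (Fin m → Carrier) → Carrier
  Σ = Σ[_] F

  Σ≡sum : ∀ m (f : Fin m → Carrier) → Σ m f ≡ sum f
  Σ≡sum zero    f = refl
  Σ≡sum (suc m) f = cong (f Fin.zero +_) (Σ≡sum m (f ∘ Fin.suc))

  Σ-cong : ∀ m {f g : Fin m → Carrier} → (∀ i → f i ≡ g i) → Σ m f ≡ Σ m g
  Σ-cong m {f} {g} f≗g rewrite Σ≡sum m f | Σ≡sum m g = sum-cong-≗ f≗g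

  Σ-+ : ∀ m (f g : Fin m → Carrier) → Σ m (λ i → f i + g i) ≡ Σ m f + Σ m g
  Σ-+ m f g rewrite Σ≡sum m (λ i → f i + g i) | Σ≡sum m f | Σ≡sum m g = ∑-distrib-+ f g

  Σ-*ˡ : ∀ m c (f : Fin m → Carrier) → Σ m (λ i → c * f i) ≡ c * Σ m f
  Σ-*ˡ m c f rewrite Σ≡sum m (λ i → c * f i) | Σ≡sum m f = sym (*-distribˡ-sum c f)

  Σ-linear : ∀ m a b (f g : Fin m → Carrier) →
    Σ m (λ i → a * f i + b * g i) ≡ a * Σ m f + b * Σ m g
  Σ-linear m a b f g = trans (Σ-+ m _ _) (cong₂ _+_ (Σ-*ˡ m a f) (Σ-*ˡ m b g))

  δ : ∀ {m} → Fin m → Fin m → Carrier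
  δ Fin.zero    Fin.zero    = 1#
  δ Fin.zero    (Fin.suc _) = 0#
  δ (Fin.suc _) Fin.zero    = 0#
  δ (Fin.suc i) (Fin.suc j) = δ i j

  δ-diag : ∀ {m} (i : Fin m) → δ i i ≡ 1#
  δ-diag Fin.zero    = refl
  δ-diag (Fin.suc i) = δ-diag i

  δ-off : ∀ {m} {i j : Fin m} → i ≢ j → δ i j ≡ 0#
  δ-off {i = Fin.zero}  {Fin.zero}  i≢j = contradiction refl i≢j
  δ-off {i = Fin.zero}  {Fin.suc _} i≢j = refl
  δ-off {i = Fin.suc _} {Fin.zero}  i≢j = refl
  δ-off {i = Fin.suc _} {Fin.suc _} i≢j = δ-off (i≢j ∘ cong Fin.suc)

  Σ-δ : ∀ m (i : Fin m) (h : Fin m → Carrier) → Σ m (λ r → δ i r * h r) ≡ h i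
  Σ-δ (suc m) Fin.zero h = begin
    1# * h Fin.zero + Σ m (λ r → 0# * h (Fin.suc r))
      ≡⟨ cong₂ _+_ (*-identityˡ _) (trans (Σ-*ˡ m 0# _) (zeroˡ _)) ⟩
    h Fin.zero + 0#  ≡⟨ +-identityʳ _ ⟩
    h Fin.zero       ∎
    where open ≡-Reasoning
  Σ-δ (suc m) (Fin.suc i) h =
    trans (cong₂ _+_ (zeroˡ _) (Σ-δ m i (h ∘ Fin.suc))) (+-identityˡ _)

  e[_]+_·e[_] : ∀ {m} → Fin m → Carrier → Fin m → Vect F m
  (e[ i ]+ c ·e[ j ]) r = δ i r + c * δ j r

  Σ-e : ∀ m (i j : Fin m) c (h : Fin m → Carrier) →
    Σ m (λ r → (e[ i ]+ c ·e[ j ]) r * h r) ≡ h i + c * h j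
  Σ-e m i j c h = begin
    Σ m (λ r → (δ i r + c * δ j r) * h r)
      ≡⟨ Σ-cong m (λ r → trans (distribʳ (h r) _ _) (cong (δ i r * h r +_) (*-assoc c _ _))) ⟩
    Σ m (λ r → δ i r * h r + c * (δ j r * h r))
      ≡⟨ Σ-+ m _ _ ⟩
    Σ m (λ r → δ i r * h r) + Σ m (λ r → c * (δ j r * h r))
      ≡⟨ cong₂ _+_ (Σ-δ m i h) (trans (Σ-*ˡ m c _) (cong (c *_) (Σ-δ m j h))) ⟩
    h i + c * h j ∎
    where open ≡-Reasoning

  e-atˡ : ∀ {m} {i j : Fin m} c → i ≢ j → (e[ i ]+ c ·e[ j ]) i ≡ 1#
  e-atˡ {i = i} c i≢j =
    trans (cong₂ _+_ (δ-diag i) (trans (cong (c *_) (δ-off (≢-sym i≢j))) (zeroʳ c))) (+-identityʳ 1#)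

  e-atʳ : ∀ {m} {i j : Fin m} c → i ≢ j → (e[ i ]+ c ·e[ j ]) j ≡ c
  e-atʳ {j = j} c i≢j =
    trans (cong₂ _+_ (δ-off i≢j) (trans (cong (c *_) (δ-diag j)) (*-identityʳ c))) (+-identityˡ c)

  e-nonZero : ∀ {m} {i j : Fin m} c → i ≢ j → NonZeroVec F (e[ i ]+ c ·e[ j ])
  e-nonZero {i = i} c i≢j e≡0 = 0≢1 (trans (sym (e≡0 i)) (e-atˡ c i≢j))

  pairing-e : ∀ {m} {i j : Fin m} a c → i ≢ j →
    pairing F (e[ j ]+ c ·e[ i ]) (e[ i ]+ a ·e[ j ]) ≡ a + c
  pairing-e {m} {i} {j} a c i≢j =
    trans (Σ-e m j i c (e[ i ]+ a ·e[ j ]))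
          (cong₂ _+_ (e-atʳ a i≢j) (trans (cong (c *_) (e-atˡ a i≢j)) (*-identityʳ c)))

  trace-mulM-scaleˡ : ∀ {m} {X Y : Matrix F m} a (D : Matrix F m) → _≈M_ F X (scaleM F a Y) →
    trace F (mulM F X D) ≡ a * trace F (mulM F Y D)
  trace-mulM-scaleˡ {m} a D X≈aY =
    trans (Σ-cong m λ r → trans (Σ-cong m λ l → trans (cong (_* D l r) (X≈aY r l)) (*-assoc a _ _))
                                (Σ-*ˡ m a _))
          (Σ-*ˡ m a _)

  trace-mulM-linearʳ : ∀ {m} (Y : Matrix F m) a b (M M' : Matrix F m) →
    trace F (mulM F Y (addM F (scaleM F a M) (scaleM F b M')))
      ≡ a * trace F (mulM F Y M) + b * trace F (mulM F Y M')
  trace-mulM-linearʳ {m} Y a b M M' =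
    trans (Σ-cong m λ r → trans (Σ-cong m λ l → entry r l) (Σ-linear m a b _ _)) (Σ-linear m a b _ _)
    where
    entry : ∀ r l → Y r l * (a * M l r + b * M' l r) ≡ a * (Y r l * M l r) + b * (Y r l * M' l r)
    entry r l = trans (distribˡ _ _ _) (cong₂ _+_ (x∙yz≈y∙xz _ _ _) (x∙yz≈y∙xz _ _ _))

  ev-linear : ∀ {m N} (X : Fin N → Matrix F m) a b M M' k →
    ev F X (addM F (scaleM F a M) (scaleM F b M')) k ≡ a * ev F X M k + b * ev F X M' k
  ev-linear X a b M M' k = trace-mulM-linearʳ (X k) a b M M'

  trivialKernel⇒injective : ∀ {m N} (f : Matrix F m → Fin N → Carrier) →
    (∀ a b M M' k → f (addM F (scaleM F a M) (scaleM F b M')) k ≡ a * f M k + b * f M' k) →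
    (∀ D → (∀ k → f D k ≡ 0#) → ∀ i j → D i j ≡ 0#) →
    ∀ M M' → (∀ k → f M k ≡ f M' k) → _≈M_ F M M'
  trivialKernel⇒injective f f-linear kernel M M' fM≡fM' i j =
    x∙y⁻¹≈ε⇒x≈y _ _ (trans (sym (1x-1y≡x-y _ _)) (kernel M-M' fM-M'≡0 i j))
    where
    M-M' : Matrix F _
    M-M' = addM F (scaleM F 1# M) (scaleM F (- 1#) M')
    fM-M'≡0 : ∀ k → f M-M' k ≡ 0#
    fM-M'≡0 k = trans (f-linear 1# (- 1#) M M' k)
                      (trans (1x-1y≡x-y _ _) (x≈y⇒x∙y⁻¹≈ε (fM≡fM' k)))

  module _ (s : Automorphism F) where
    open Automorphism s

    σ-0 : σ 0# ≡ 0#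
    σ-0 = x+x≈x⇒x≈0 (σ 0#) (trans (sym (σ-+ 0# 0#)) (cong σ (+-identityˡ 0#)))

    σ-δ : ∀ {m} (i j : Fin m) → σ (δ i j) ≡ δ i j
    σ-δ Fin.zero    Fin.zero    = σ-1
    σ-δ Fin.zero    (Fin.suc _) = σ-0
    σ-δ (Fin.suc _) Fin.zero    = σ-0
    σ-δ (Fin.suc i) (Fin.suc j) = σ-δ i j

    σ-e : ∀ {m} (i j : Fin m) a r → σ ((e[ i ]+ a ·e[ j ]) r) ≡ (e[ i ]+ σ a ·e[ j ]) r
    σ-e i j a r = trans (σ-+ _ _) (cong₂ _+_ (σ-δ i r) (trans (σ-* a _) (cong (σ a *_) (σ-δ j r))))

    -- ξ D x^σ, the paper's Tr(x^σ ξ D)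
    twistedForm : ∀ {m} → Matrix F m → Vect F m → Vect F m → Carrier
    twistedForm D ξ x = pairing F (σ ∘ x) (λ r → pairing F ξ (λ l → D l r))

    trace-twistedOuter : ∀ {m} (x ξ : Vect F m) (D : Matrix F m) →
      trace F (mulM F (twistedOuter F s x ξ) D) ≡ twistedForm D ξ x
    trace-twistedOuter {m} x ξ D =
      Σ-cong m λ r → trans (Σ-cong m λ l → *-assoc (σ (x r)) (ξ l) (D l r)) (Σ-*ˡ m (σ (x r)) _)

    twistedForm-e : ∀ {m} (D : Matrix F m) (i j : Fin m) a c →
      twistedForm D (e[ j ]+ c ·e[ i ]) (e[ i ]+ a ·e[ j ])
        ≡ (D j i + c * D i i) + σ a * (D j j + c * D i j)
    twistedForm-e {m} D i j a c = begin
      Σ m (λ r → σ ((e[ i ]+ a ·e[ j ]) r) * pairing F (e[ j ]+ c ·e[ i ]) (λ l → D l r))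
        ≡⟨ Σ-cong m (λ r → cong₂ _*_ (σ-e i j a r) (Σ-e m j i c (λ l → D l r))) ⟩
      Σ m (λ r → (e[ i ]+ σ a ·e[ j ]) r * (D j r + c * D i r))
        ≡⟨ Σ-e m i j (σ a) (λ r → D j r + c * D i r) ⟩
      (D j i + c * D i i) + σ a * (D j j + c * D i j) ∎
      where open ≡-Reasoning

    VanishesOnIncidentPairs : ∀ {m} → Matrix F m → Set
    VanishesOnIncidentPairs D = ∀ x ξ → NonZeroVec F x → NonZeroVec F ξ →
      pairing F ξ x ≡ 0# → twistedForm D ξ x ≡ 0#

    module _ {m} (D : Matrix F m) (D-vanishes : VanishesOnIncidentPairs D) where

      cross-identity : ∀ {i j} → i ≢ j → ∀ a c → a + c ≡ 0# →
        (D j i + c * D i i) + σ a * (D j j + c * D i j) ≡ 0#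
      cross-identity i≢j a c a+c≡0 =
        trans (sym (twistedForm-e D _ _ a c))
              (D-vanishes _ _ (e-nonZero a i≢j) (e-nonZero c (≢-sym i≢j))
                          (trans (pairing-e a c i≢j) a+c≡0))

      offDiagonal : ∀ {i j} → i ≢ j → D j i ≡ 0#
      offDiagonal {i} {j} i≢j = begin
        D j i                            ≡⟨ sym (trans (+-identityʳ _) (+-identityʳ _)) ⟩
        (D j i + 0#) + 0#                ≡⟨ sym (cong₂ _+_ (cong (D j i +_) (zeroˡ _)) σ0*W≡0) ⟩
        (D j i + 0# * D i i) + σ 0# * W  ≡⟨ cross-identity i≢j 0# 0# (+-identityˡ 0#) ⟩
        0#                               ∎
        where
        open ≡-Reasoning
        W = D j j + 0# * D i j
        σ0*W≡0 : σ 0# * W ≡ 0#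
        σ0*W≡0 = trans (cong (_* W) σ-0) (zeroˡ W)

      diagonal-relation : ∀ {i j} → i ≢ j → ∀ a → σ a * D j j ≡ a * D i i
      diagonal-relation {i} {j} i≢j a = +-cancelˡ (- a * D i i) _ _ (begin
        - a * D i i + σ a * D j j
          ≡⟨ sym (cong₂ _+_ (+-identityˡ _) (cong (σ a *_) Djj-a0≡Djj)) ⟩
        (0# + - a * D i i) + σ a * (D j j + - a * 0#)
          ≡⟨ cong₂ (λ u v → (u + - a * D i i) + σ a * (D j j + - a * v))
                   (sym (offDiagonal i≢j)) (sym (offDiagonal (≢-sym i≢j))) ⟩
        (D j i + - a * D i i) + σ a * (D j j + - a * D i j)
          ≡⟨ cross-identity i≢j a (- a) (-‿inverseʳ a) ⟩
        0#
          ≡⟨ sym -aDii+aDii≡0 ⟩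
        - a * D i i + a * D i i ∎)
        where
        open ≡-Reasoning
        Djj-a0≡Djj : D j j + - a * 0# ≡ D j j
        Djj-a0≡Djj = trans (cong (D j j +_) (zeroʳ (- a))) (+-identityʳ _)
        -aDii+aDii≡0 : - a * D i i + a * D i i ≡ 0#
        -aDii+aDii≡0 =
          trans (sym (distribʳ (D i i) (- a) a)) (trans (cong (_* D i i) (-‿inverseˡ a)) (zeroˡ _))

    σa*d′≡a*d⇒d≡0 : NonTrivial F s → ∀ {d d′} → (∀ a → σ a * d′ ≡ a * d) → d ≡ 0#
    σa*d′≡a*d⇒d≡0 σ≢id {d} {d′} σa*d′≡a*d with d ≟ 0#
    ... | yes d≡0 = d≡0
    ... | no  d≢0 = contradiction σ≡id σ≢id
      where
      open ≡-Reasoning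
      d′≡d : d′ ≡ d
      d′≡d = begin
        d′         ≡⟨ sym (*-identityˡ d′) ⟩
        1# * d′    ≡⟨ cong (_* d′) (sym σ-1) ⟩
        σ 1# * d′  ≡⟨ σa*d′≡a*d 1# ⟩
        1# * d     ≡⟨ *-identityˡ d ⟩
        d          ∎
      σ≡id : ∀ a → σ a ≡ a
      σ≡id a = *-cancelʳ-≢0 (σ a) a d≢0 (subst (λ u → σ a * u ≡ a * d) d′≡d (σa*d′≡a*d a))

    vanishing⇒zero : NonTrivial F s → ∀ {n} (D : Matrix F (suc (suc n))) →
      VanishesOnIncidentPairs D → ∀ i j → D i j ≡ 0#
    vanishing⇒zero σ≢id D D-vanishes i j with i Fin.≟ j
    ... | yes refl = σa*d′≡a*d⇒d≡0 σ≢id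
                       (diagonal-relation D D-vanishes (≢-sym (punchInᵢ≢i i Fin.zero)))
    ... | no  i≢j  = offDiagonal D D-vanishes (≢-sym i≢j)

    ev≡0⇒vanishing : ∀ {m N} (X : Fin N → Matrix F m) →
      (∀ Y → IsΛGenerator F s Y → ∃ λ k → SamePoint F (X k) Y) →
      ∀ D → (∀ k → ev F X D k ≡ 0#) → VanishesOnIncidentPairs D
    ev≡0⇒vanishing X covers D evD≡0 x ξ x≢0 ξ≢0 ξx≡0
      with covers (twistedOuter F s x ξ) (x , ξ , x≢0 , ξ≢0 , ξx≡0 , λ _ _ → refl)
    ... | k , a , a≢0 , Xk≈aY = *-cancelʳ-≢0 _ _ a≢0 (begin
      twistedForm D ξ x * a                          ≡⟨ *-comm _ a ⟩
      a * twistedForm D ξ x                          ≡⟨ cong (a *_) (sym (trace-twistedOuter x ξ D)) ⟩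
      a * trace F (mulM F (twistedOuter F s x ξ) D)  ≡⟨ sym (trace-mulM-scaleˡ a D Xk≈aY) ⟩
      trace F (mulM F (X k) D)                       ≡⟨ evD≡0 k ⟩
      0#                                             ≡⟨ sym (zeroˡ a) ⟩
      0# * a                                         ∎)
      where open ≡-Reasoning

lemma3p1 : (q : ℕ) → IsPrimePower q → (F : FiniteField q) →
    (n : ℕ) → 1 ≤ n →
    (s : Automorphism F) → NonTrivial F s →
    (N : ℕ) → (X : Fin N → Matrix F (suc n)) → Representatives F s N X →
    IsVSIsoOntoCode F X (ev F X)
lemma3p1 _ _ F (suc n) (s≤s z≤n) s σ≢id _ X (_ , covers , _) =
  (λ M → M , λ _ → refl) ,
  ev-linear F X ,
  trivialKernel⇒injective F (ev F X) (ev-linear F X) ev-kernel ,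
  (λ _ c∈C → c∈C)
  where
  open FiniteField F using (0#)
  ev-kernel : ∀ D → (∀ k → ev F X D k ≡ 0#) → ∀ i j → D i j ≡ 0#
  ev-kernel D evD≡0 = vanishing⇒zero F s σ≢id D (ev≡0⇒vanishing F s X covers D evD≡0)
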